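{- Let $R$ be an $n$-tournament ($n\ge 2$) with vertices $v_1,\dots,v_n$, and let $T_1,\dots,T_n$ be tournaments. If $T_i$ is not transitive for some $i\in\{1,\dots,n\}$, then there exists a subtournament $R_s$ of $R(T_1,\dots,T_n)$ such that $\det(R_s)=9\cdot\det(R)$.
   Context: A tournament is a directed graph with exactly one arc between each pair of distinct vertices; $u\rightarrow v$ means the arc goes from $u$ to $v$. For a tournament $T$ on vertices $v_1,\dots,v_n$, its skew-adjacency matrix is the zero-diagonal matrix $S_T=[s_{ij}]$ with $s_{ij}=-s_{ji}=1$ if $v_i\rightarrow v_j$, and $\det(T):=\det(S_T)$. A subtournament is the tournament induced by a nonempty vertex subset. A tournament is transitive if it has no directed 3-cycle. For an $n$-tournament $R$ with vertices $v_1,\dots,v_n$ and tournaments $T_1,\dots,T_n$ (on pairwise disjoint vertex sets), the blowup $R(T_1,\dots,T_n)$ is obtained by replacing each $v_i$ by $T_i$ and adding all arcs from $V(T_i)$ to $V(T_j)$ whenever $v_i\rightarrow v_j$ in $R$. -}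

module Defs where

open import Data.Nat using (ℕ; zero; suc)
open import Data.Bool using (Bool; true; false; not; if_then_else_)
open import Data.Fin using (Fin; zero; suc; punchIn; _≟_)
open import Data.Integer using (ℤ; +_; -_; _+_; _*_; 0ℤ; 1ℤ)
open import Data.Product using (Σ; _×_; ∃; _,_; proj₁; proj₂)
open import Relation.Binary.PropositionalEquality using (_≡_; _≢_; refl)
open import Relation.Nullary using (¬_; yes; no)

Arcs : Set → Set
Arcs V = V → V → Bool

IsTournament : {V : Set} → Arcs V → Set
IsTournament {V} a =
  (∀ v → a v v ≡ false) × (∀ u v → u ≢ v → a u v ≡ not (a v u))

Tournament : ℕ → Set
Tournament n = Σ (Arcs (Fin n)) IsTournament

IsTransitive : {V : Set} → Arcs V → Set
IsTransitive {V} a =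
  ¬ (Σ V λ x → Σ V λ y → Σ V λ z →
       (a x y ≡ true) × (a y z ≡ true) × (a z x ≡ true))

skew : {m : ℕ} → Arcs (Fin m) → Fin m → Fin m → ℤ
skew a i j = if a i j then 1ℤ else (if a j i then - 1ℤ else 0ℤ)

sumFin : (n : ℕ) → (Fin n → ℤ) → ℤ
sumFin zero f = 0ℤ
sumFin (suc n) f = f zero + sumFin n (λ i → f (suc i))

sign : {n : ℕ} → Fin n → ℤ
sign zero = 1ℤ
sign (suc i) = - sign i

det : (n : ℕ) → (Fin n → Fin n → ℤ) → ℤ
det zero M = 1ℤ
det (suc n) M =
  sumFin (suc n) λ i → sign i * M i zero * det n (λ r c → M (punchIn i r) (suc c))

detT : {m : ℕ} → Arcs (Fin m) → ℤ
detT {m} a = det m (skew a)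

blowup : {n : ℕ} (R : Arcs (Fin n)) (k : Fin n → ℕ) (T : (i : Fin n) → Arcs (Fin (k i)))
       → Arcs (Σ (Fin n) λ i → Fin (k i))
blowup R k T (i , x) (j , y) with i ≟ j
... | yes refl = T i x y
... | no _     = R i j

-- Subtournament induced by the (nonempty) vertex set image of an injective f : Fin m → V,
-- with vertices listed as f 0, …, f (m-1).
induced : {V : Set} {m : ℕ} → Arcs V → (Fin m → V) → Arcs (Fin m)
induced a f i j = a (f i) (f j)

Injective : {A B : Set} → (A → B) → Set
Injective f = ∀ x y → f x ≡ f y → x ≡ y

-- Replace v_i by a directed 3-cycle x → y → z → x of T_i and every other v_j by one vertex of T_j.
-- In the skew matrix of this subtournament, ordered y, z, then the vertices of R (with x in place of v_i),
-- adding suitable multiples of the columns of y and z to the other columns clears the rows of y and z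
-- except for the 2×2 block [[0,1],[-1,0]] of determinant 1, and leaves in the remaining block S_R with
-- row i and column i multiplied by 3 (the entry at (i,i) being 0).
module Submission where

open import Data.Nat using (ℕ; _≤_; zero; suc; s≤s; z≤n)
open import Data.Bool using (true; false; not)
import Data.Bool.Properties as Bool
open import Data.Fin using (Fin; zero; suc; punchIn; punchOut; _≟_; lift; fromℕ<)
open import Data.Fin.Properties
  using (any?; suc-injective; punchInᵢ≢i; punchIn-punchOut; punchIn-injective)
open import Data.Integer using (ℤ; +_; _*_; -_; _+_; 0ℤ; 1ℤ; -1ℤ; -[1+_])
open import Data.Integer.Properties
  using ( +-*-semiring; +-0-abelianGroup; +-assoc; +-identityʳ; +-inverseˡ
        ; *-zeroʳ; *-identityˡ; neg-involutive)
open import Data.Integer.Tactic.RingSolver using (solve-∀)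
open import Algebra.Properties.AbelianGroup +-0-abelianGroup using (inverseʳ-unique)
open import Algebra.Properties.Semiring.Sum +-*-semiring
  using (sum; sum-cong-≗; ∑-distrib-+; *-distribˡ-sum; sum-remove; sum-replicate-zero)
open import Data.Product using (Σ; _×_; _,_; proj₁; proj₂)
open import Data.Product.Properties using (,-injectiveˡ)
open import Data.Unit using (⊤; tt)
open import Function using (_∘_)
open import Relation.Binary.PropositionalEquality
open import Relation.Nullary using (¬_; Dec; yes; no; contradiction)
open import Relation.Nullary.Decidable using (_×-dec_; decidable-stable)
open import Defs

open ≡-Reasoning

sumFin≡sum : ∀ n (f : Fin n → ℤ) → sumFin n f ≡ sum f
sumFin≡sum zero    f = refl
sumFin≡sum (suc n) f = cong (_+_ (f zero)) (sumFin≡sum n (f ∘ suc))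

sumFin-cong : ∀ n {f g : Fin n → ℤ} → (∀ i → f i ≡ g i) → sumFin n f ≡ sumFin n g
sumFin-cong n {f} {g} f≗g =
  trans (sumFin≡sum n f) (trans (sum-cong-≗ f≗g) (sym (sumFin≡sum n g)))

sumFin-zero : ∀ n (f : Fin n → ℤ) → (∀ i → f i ≡ 0ℤ) → sumFin n f ≡ 0ℤ
sumFin-zero n f f≗0 = trans (sumFin-cong n f≗0) (trans (sumFin≡sum n _) (sum-replicate-zero n))

sumFin-distrib-+ : ∀ n (f g : Fin n → ℤ) → sumFin n (λ i → f i + g i) ≡ sumFin n f + sumFin n g
sumFin-distrib-+ n f g =
  trans (sumFin≡sum n _)
        (trans (∑-distrib-+ f g) (sym (cong₂ _+_ (sumFin≡sum n f) (sumFin≡sum n g))))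

*-distribˡ-sumFin : ∀ n x (f : Fin n → ℤ) → x * sumFin n f ≡ sumFin n (λ i → x * f i)
*-distribˡ-sumFin n x f =
  trans (cong (x *_) (sumFin≡sum n f)) (trans (*-distribˡ-sum x f) (sym (sumFin≡sum n _)))

sumFin-concentrated : ∀ n (f : Fin (suc n) → ℤ) z → (∀ r → f (punchIn z r) ≡ 0ℤ)
  → sumFin (suc n) f ≡ f z
sumFin-concentrated n f z others≡0 = begin
  sumFin (suc n) f            ≡⟨ sumFin≡sum (suc n) f ⟩
  sum f                       ≡⟨ sum-remove {i = z} f ⟩
  f z + sum (f ∘ punchIn z)   ≡⟨ cong (_+_ (f z)) others-sum≡0 ⟩
  f z + 0ℤ                    ≡⟨ +-identityʳ (f z) ⟩
  f z                         ∎
  where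
  others-sum≡0 : sum (f ∘ punchIn z) ≡ 0ℤ
  others-sum≡0 = trans (sym (sumFin≡sum n _)) (sumFin-zero n _ others≡0)

Matrix : ℕ → Set
Matrix n = Fin n → Fin n → ℤ

minor : ∀ {n} → Matrix (suc n) → Fin (suc n) → Matrix n
minor M p r c = M (punchIn p r) (suc c)

cofactorTerm : ∀ {n} → Matrix (suc n) → Fin (suc n) → ℤ
cofactorTerm {n} M p = sign p * M p zero * det n (minor M p)

det-cong : ∀ n {M N : Matrix n} → (∀ r c → M r c ≡ N r c) → det n M ≡ det n N
det-cong zero    M≗N = refl
det-cong (suc n) M≗N = sumFin-cong (suc n) λ p →
  cong₂ (λ a d → sign p * a * d) (M≗N p zero) (det-cong n λ r c → M≗N (punchIn p r) (suc c))

det-scaleTerms : ∀ n x {M N : Matrix (suc n)}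
  → (∀ p → cofactorTerm N p ≡ x * cofactorTerm M p) → det (suc n) N ≡ x * det (suc n) M
det-scaleTerms n x {M} terms =
  trans (sumFin-cong (suc n) terms) (sym (*-distribˡ-sumFin (suc n) x (cofactorTerm M)))

scale-entry : ∀ s x a d → s * (x * a) * d ≡ x * (s * a * d)
scale-entry = solve-∀

scale-minor : ∀ s x a d → s * a * (x * d) ≡ x * (s * a * d)
scale-minor = solve-∀

det-scaleRow : ∀ n (z : Fin n) x {M N : Matrix n}
  → (∀ r c → r ≢ z → N r c ≡ M r c) → (∀ c → N z c ≡ x * M z c)
  → det n N ≡ x * det n M
det-scaleRow (suc n) z x {M} {N} off on = det-scaleTerms n x {M} {N} term
  where
  term : ∀ p → cofactorTerm N p ≡ x * cofactorTerm M p
  term p with p ≟ z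
  ... | yes refl = trans (cong₂ (λ a d → sign p * a * d) (on zero)
                           (det-cong n λ r c → off (punchIn p r) (suc c) (punchInᵢ≢i p r)))
                         (scale-entry (sign p) x _ _)
  ... | no p≢z = trans (cong₂ (λ a d → sign p * a * d) (off p zero p≢z)
                             (det-scaleRow n (punchOut p≢z) x {minor M p} {minor N p} off′ on′))
                       (scale-minor (sign p) x _ _)
    where
    off′ : ∀ r c → r ≢ punchOut p≢z → N (punchIn p r) (suc c) ≡ M (punchIn p r) (suc c)
    off′ r c r≢z′ = off (punchIn p r) (suc c)
      λ e → r≢z′ (punchIn-injective p r _ (trans e (sym (punchIn-punchOut p≢z))))
    on′ : ∀ c → N (punchIn p (punchOut p≢z)) (suc c) ≡ x * M (punchIn p (punchOut p≢z)) (suc c)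
    on′ c = subst (λ r → N r (suc c) ≡ x * M r (suc c)) (sym (punchIn-punchOut p≢z)) (on (suc c))

det-zeroRow : ∀ n (M : Matrix n) z → (∀ c → M z c ≡ 0ℤ) → det n M ≡ 0ℤ
det-zeroRow n M z row≡0 = det-scaleRow n z 0ℤ (λ _ _ _ → refl) row≡0

det-scaleCol : ∀ n (t : Fin n) x {M N : Matrix n}
  → (∀ r c → c ≢ t → N r c ≡ M r c) → (∀ r → N r t ≡ x * M r t)
  → det n N ≡ x * det n M
det-scaleCol (suc n) zero x {M} {N} off on = det-scaleTerms n x {M} {N} λ p →
  trans (cong₂ (λ a d → sign p * a * d) (on p) (det-cong n λ r c → off (punchIn p r) (suc c) λ ()))
        (scale-entry (sign p) x _ _)
det-scaleCol (suc n) (suc t) x {M} {N} off on = det-scaleTerms n x {M} {N} λ p →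
  trans (cong₂ (λ a d → sign p * a * d) (off p zero λ ())
               (det-scaleCol n t x {minor M p} {minor N p}
                  (λ r c c≢t → off (punchIn p r) (suc c) (c≢t ∘ suc-injective)) (on ∘ punchIn p)))
        (scale-minor (sign p) x _ _)

-- G p q stands for the value of G at the ordered pair (p , punchIn p q) of distinct indices.
-- SwapRelated _∼_ N G says that this value is ∼-related to the value at the reversed pair:
-- (0 , 1+q) reverses to (1+q , 0), and pairs of nonzero indices are handled recursively.
SwapRelated : {A : Set} → (A → A → Set) → ∀ N → (Fin (suc N) → Fin N → A) → Set
SwapRelated _∼_ zero    G = ⊤
SwapRelated _∼_ (suc N) G =
  (∀ q → G zero q ∼ G (suc q) zero) × SwapRelated _∼_ N (λ p q → G (suc p) (suc q))

SwapRelated-cong : ∀ {A} {_∼_ : A → A → Set} N {G G′ : Fin (suc N) → Fin N → A}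
  → (∀ p q → G p q ≡ G′ p q) → SwapRelated _∼_ N G → SwapRelated _∼_ N G′
SwapRelated-cong zero    G≗G′ _ = tt
SwapRelated-cong {_∼_ = _∼_} (suc N) G≗G′ (top , rest) =
  (λ q → subst₂ _∼_ (G≗G′ zero q) (G≗G′ (suc q) zero) (top q)) ,
  SwapRelated-cong N (λ p q → G≗G′ (suc p) (suc q)) rest

doubleSum-swapAntisymmetric : ∀ N (G : Fin (suc N) → Fin N → ℤ)
  → SwapRelated (λ u v → u ≡ - v) N G → sumFin (suc N) (λ p → sumFin N (G p)) ≡ 0ℤ
doubleSum-swapAntisymmetric zero    G _ = refl
doubleSum-swapAntisymmetric (suc N) G (top , rest) = begin
    fromZero + sumFin (suc N) (λ p → G (suc p) zero + innerRow p)
  ≡⟨ cong (_+_ fromZero) (sumFin-distrib-+ (suc N) (λ p → G (suc p) zero) innerRow) ⟩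
    fromZero + (toZero + inner)
  ≡⟨ +-assoc fromZero toZero inner ⟨
    (fromZero + toZero) + inner
  ≡⟨ cong₂ _+_ (trans (sym (sumFin-distrib-+ (suc N) (G zero) (λ q → G (suc q) zero)))
                      (sumFin-zero (suc N) _ pairs-cancel))
               (doubleSum-swapAntisymmetric N _ rest) ⟩
    0ℤ
  ∎
  where
  innerRow : Fin (suc N) → ℤ
  innerRow p = sumFin N (λ q → G (suc p) (suc q))
  fromZero toZero inner : ℤ
  fromZero = sumFin (suc N) (G zero)
  toZero   = sumFin (suc N) (λ p → G (suc p) zero)
  inner    = sumFin (suc N) innerRow
  pairs-cancel : ∀ q → G zero q + G (suc q) zero ≡ 0ℤ
  pairs-cancel q = trans (cong (_+ G (suc q) zero) (top q)) (+-inverseˡ (G (suc q) zero))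

-- Deleting rows p and then punchIn p q leaves the same rows, in the same order, as deleting them in reverse.
punchIn²-swapSymmetric : ∀ K (H : (Fin K → Fin (suc (suc K))) → ℤ)
  → (∀ {g g′} → (∀ r → g r ≡ g′ r) → H g ≡ H g′)
  → SwapRelated _≡_ (suc K) (λ p q → H (punchIn p ∘ punchIn q))
punchIn²-swapSymmetric zero    H H-cong = (λ q → refl) , tt
punchIn²-swapSymmetric (suc K) H H-cong =
  (λ q → refl) ,
  SwapRelated-cong (suc K) (λ p q → H-cong (lift-punchIn² p q))
    (punchIn²-swapSymmetric K (H ∘ lift 1) λ g≗g′ → H-cong (lift-cong g≗g′))
  where
  lift-cong : ∀ {g g′ : Fin K → Fin (suc (suc K))} → (∀ r → g r ≡ g′ r)
    → ∀ r → lift 1 g r ≡ lift 1 g′ r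
  lift-cong g≗g′ zero    = refl
  lift-cong g≗g′ (suc r) = cong suc (g≗g′ r)
  lift-punchIn² : ∀ p q r → lift 1 (punchIn p ∘ punchIn q) r ≡ punchIn (suc p) (punchIn (suc q) r)
  lift-punchIn² p q zero    = refl
  lift-punchIn² p q (suc r) = refl

signedTerm-swapAntisymmetric : ∀ N (F : Fin (suc N) → Fin (suc N) → ℤ) → (∀ a b → F a b ≡ F b a)
  → (E : Fin (suc N) → Fin N → ℤ) → SwapRelated _≡_ N E
  → SwapRelated (λ u v → u ≡ - v) N (λ p q → sign p * sign q * F p (punchIn p q) * E p q)
signedTerm-swapAntisymmetric zero    F F-sym E _ = tt
signedTerm-swapAntisymmetric (suc N) F F-sym E (top , rest) =
  (λ q → trans (cong₂ (λ f e → 1ℤ * sign q * f * e) (F-sym zero (suc q)) (top q))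
               (flip-sign (sign q) _ _)) ,
  SwapRelated-cong N (λ p q → signs-cancel (sign p) (sign q) _ _)
    (signedTerm-swapAntisymmetric N (λ a b → F (suc a) (suc b)) (λ a b → F-sym (suc a) (suc b)) _ rest)
  where
  flip-sign : ∀ s f e → 1ℤ * s * f * e ≡ - ((- s) * 1ℤ * f * e)
  flip-sign = solve-∀
  signs-cancel : ∀ s t f e → s * t * f * e ≡ (- s) * (- t) * f * e
  signs-cancel = solve-∀

swap₀₁ : ∀ {n} → Fin (suc (suc n)) → Fin (suc (suc n))
swap₀₁ zero          = suc zero
swap₀₁ (suc zero)    = zero
swap₀₁ (suc (suc c)) = suc (suc c)

-- Expanding twice along the first column writes det M + det (M with columns 0 and 1 swapped) as a sum
-- over ordered pairs of distinct rows whose summands are antisymmetric in the pair.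
det-swapColumns₀₁ : ∀ n (M : Matrix (suc (suc n)))
  → det (suc (suc n)) (λ r c → M r (swap₀₁ c)) ≡ - det (suc (suc n)) M
det-swapColumns₀₁ n M = inverseʳ-unique (det (suc (suc n)) M) (det (suc (suc n)) M′) sum≡0
  where
  M′ : Matrix (suc (suc n))
  M′ r c = M r (swap₀₁ c)
  F : Fin (suc (suc n)) → Fin (suc (suc n)) → ℤ
  F a b = M a zero * M b (suc zero) + M a (suc zero) * M b zero
  F-sym : ∀ a b → F a b ≡ F b a
  F-sym a b = swap-products (M a zero) (M b (suc zero)) (M a (suc zero)) (M b zero)
    where swap-products : ∀ a b c d → a * b + c * d ≡ d * c + b * a
          swap-products = solve-∀
  H : (Fin n → Fin (suc (suc n))) → ℤ
  H g = det n (λ r c → M (g r) (suc (suc c)))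
  H-cong : ∀ {g g′} → (∀ r → g r ≡ g′ r) → H g ≡ H g′
  H-cong g≗g′ = det-cong n λ r c → cong (λ t → M t (suc (suc c))) (g≗g′ r)
  pairTerm : Fin (suc (suc n)) → Fin (suc n) → ℤ
  pairTerm p q = sign p * sign q * F p (punchIn p q) * H (punchIn p ∘ punchIn q)
  secondColumnTerm : Matrix (suc (suc n)) → Fin (suc (suc n)) → Fin (suc n) → ℤ
  secondColumnTerm N p q = sign q * N (punchIn p q) (suc zero) * H (punchIn p ∘ punchIn q)
  columnTerms : ∀ p → cofactorTerm M p + cofactorTerm M′ p ≡ sumFin (suc n) (pairTerm p)
  columnTerms p =
    trans (cong₂ _+_ (*-distribˡ-sumFin (suc n) (sign p * M p zero) (secondColumnTerm M p))
                     (*-distribˡ-sumFin (suc n) (sign p * M′ p zero) (secondColumnTerm M′ p)))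
    (trans (sym (sumFin-distrib-+ (suc n) (λ q → sign p * M p zero * secondColumnTerm M p q)
                                           (λ q → sign p * M′ p zero * secondColumnTerm M′ p q)))
    (sumFin-cong (suc n) λ q → collect (sign p) (sign q) (M p zero) (M (punchIn p q) (suc zero))
                                        (M p (suc zero)) (M (punchIn p q) zero) (H (punchIn p ∘ punchIn q))))
    where collect : ∀ s t a b a′ b′ d
                    → s * a * (t * b * d) + s * a′ * (t * b′ * d) ≡ s * t * (a * b + a′ * b′) * d
          collect = solve-∀
  sum≡0 : det (suc (suc n)) M + det (suc (suc n)) M′ ≡ 0ℤ
  sum≡0 = trans (sym (sumFin-distrib-+ (suc (suc n)) (cofactorTerm M) (cofactorTerm M′)))
          (trans (sumFin-cong (suc (suc n)) columnTerms)
          (doubleSum-swapAntisymmetric (suc n) pairTerm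
            (signedTerm-swapAntisymmetric (suc n) F F-sym (λ p q → H (punchIn p ∘ punchIn q))
              (punchIn²-swapSymmetric n H H-cong))))

det≡-det-swapColumns₀₁ : ∀ n (M : Matrix (suc (suc n)))
  → det (suc (suc n)) M ≡ - det (suc (suc n)) (λ r c → M r (swap₀₁ c))
det≡-det-swapColumns₀₁ n M =
  trans (sym (neg-involutive (det (suc (suc n)) M))) (cong -_ (sym (det-swapColumns₀₁ n M)))

x≡-x⇒x≡0 : ∀ x → x ≡ - x → x ≡ 0ℤ
x≡-x⇒x≡0 (+ zero)   _  = refl
x≡-x⇒x≡0 (+ suc _)  ()
x≡-x⇒x≡0 -[1+ _ ]   ()

mutual
  det-equalColumns : ∀ n (M : Matrix n) {t u} → t ≢ u → (∀ r → M r t ≡ M r u) → det n M ≡ 0ℤ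
  det-equalColumns (suc n) M {zero}  {zero}  t≢u _    = contradiction refl t≢u
  det-equalColumns (suc n) M {zero}  {suc u} _   same = det-equalColumn₀ n M u same
  det-equalColumns (suc n) M {suc t} {zero}  _   same = det-equalColumn₀ n M t (sym ∘ same)
  det-equalColumns (suc n) M {suc t} {suc u} t≢u same = det-equalColumnsˢ n M (t≢u ∘ cong suc) same

  det-equalColumnsˢ : ∀ n (M : Matrix (suc n)) {t u} → t ≢ u → (∀ r → M r (suc t) ≡ M r (suc u))
    → det (suc n) M ≡ 0ℤ
  det-equalColumnsˢ n M t≢u same = sumFin-zero (suc n) (cofactorTerm M) λ p →
    trans (cong (sign p * M p zero *_) (det-equalColumns n (minor M p) t≢u (same ∘ punchIn p)))
          (*-zeroʳ (sign p * M p zero))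

  det-equalColumn₀ : ∀ n (M : Matrix (suc n)) u → (∀ r → M r zero ≡ M r (suc u))
    → det (suc n) M ≡ 0ℤ
  det-equalColumn₀ (suc n) M zero same =
    x≡-x⇒x≡0 _ (trans (det-cong (suc (suc n)) swapped) (det-swapColumns₀₁ n M))
    where
    swapped : ∀ r c → M r c ≡ M r (swap₀₁ c)
    swapped r zero          = same r
    swapped r (suc zero)    = sym (same r)
    swapped r (suc (suc c)) = refl
  det-equalColumn₀ (suc n) M (suc u) same =
    trans (det≡-det-swapColumns₀₁ n M)
          (cong -_ (det-equalColumnsˢ (suc n) (λ r c → M r (swap₀₁ c)) {zero} {suc u} (λ ()) same))

mutual
  det-addColumnMultiples : ∀ n (M : Matrix n) s (k : Fin n → ℤ) → k s ≡ 0ℤ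
    → det n (λ r c → M r c + k c * M r s) ≡ det n M
  det-addColumnMultiples (suc n) M (suc s) k ks≡0 = det-addColumnMultiplesˢ n M s k ks≡0
  det-addColumnMultiples (suc zero) M zero k k₀≡0 =
    det-cong 1 {M = λ r c → M r c + k c * M r zero} {N = M} λ where
      r zero → trans (cong (λ a → M r zero + a * M r zero) k₀≡0) (+-identityʳ (M r zero))
  det-addColumnMultiples (suc (suc n)) M zero k k₀≡0 = begin
      det (suc (suc n)) (λ r c → M r c + k c * M r zero)
    ≡⟨ det≡-det-swapColumns₀₁ n (λ r c → M r c + k c * M r zero) ⟩
      - det (suc (suc n)) (λ r c → M′ r c + k (swap₀₁ c) * M′ r (suc zero))
    ≡⟨ cong -_ (det-addColumnMultiplesˢ (suc n) M′ zero (k ∘ swap₀₁) k₀≡0) ⟩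
      - det (suc (suc n)) M′
    ≡⟨ det≡-det-swapColumns₀₁ n M ⟨
      det (suc (suc n)) M
    ∎
    where
    M′ : Matrix (suc (suc n))
    M′ r c = M r (swap₀₁ c)

  -- Expanding along column 0, the column operation acts on each minor, and what column 0 picks up is
  -- k 0 times the determinant of a matrix whose columns 0 and 1+s coincide.
  det-addColumnMultiplesˢ : ∀ n (M : Matrix (suc n)) s (k : Fin (suc n) → ℤ) → k (suc s) ≡ 0ℤ
    → det (suc n) (λ r c → M r c + k c * M r (suc s)) ≡ det (suc n) M
  det-addColumnMultiplesˢ n M s k ks≡0 = begin
      sumFin (suc n) (λ p → sign p * (M p zero + k zero * M p (suc s))
                            * det n (λ r c → M (punchIn p r) (suc c) + k (suc c) * M (punchIn p r) (suc s)))
    ≡⟨ sumFin-cong (suc n) (λ p → cong (sign p * (M p zero + k zero * M p (suc s)) *_)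
                                       (det-addColumnMultiples n (minor M p) s (k ∘ suc) ks≡0)) ⟩
      sumFin (suc n) (λ p → sign p * (M p zero + k zero * M p (suc s)) * det n (minor M p))
    ≡⟨ sumFin-cong (suc n) (λ p → split (sign p) (M p zero) (k zero) (M p (suc s)) (det n (minor M p))) ⟩
      sumFin (suc n) (λ p → cofactorTerm M p + k zero * cofactorTerm Ms p)
    ≡⟨ sumFin-distrib-+ (suc n) (cofactorTerm M) (λ p → k zero * cofactorTerm Ms p) ⟩
      det (suc n) M + sumFin (suc n) (λ p → k zero * cofactorTerm Ms p)
    ≡⟨ cong (_+_ (det (suc n) M)) (sym (*-distribˡ-sumFin (suc n) (k zero) (cofactorTerm Ms))) ⟩
      det (suc n) M + k zero * det (suc n) Ms
    ≡⟨ cong (λ d → det (suc n) M + k zero * d) Ms-singular ⟩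
      det (suc n) M + k zero * 0ℤ
    ≡⟨ cong (_+_ (det (suc n) M)) (*-zeroʳ (k zero)) ⟩
      det (suc n) M + 0ℤ
    ≡⟨ +-identityʳ (det (suc n) M) ⟩
      det (suc n) M
    ∎
    where
    Ms : Matrix (suc n)
    Ms r zero    = M r (suc s)
    Ms r (suc c) = M r (suc c)
    Ms-singular : det (suc n) Ms ≡ 0ℤ
    Ms-singular = det-equalColumns (suc n) Ms {zero} {suc s} (λ ()) λ _ → refl
    split : ∀ s a x b d → s * (a + x * b) * d ≡ s * a * d + x * (s * b * d)
    split = solve-∀

addToLaterColumns : ∀ {n} → Matrix (suc (suc n)) → (a b : Fin n → ℤ) → Matrix (suc (suc n))
addToLaterColumns M a b r zero          = M r zero
addToLaterColumns M a b r (suc zero)    = M r (suc zero)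
addToLaterColumns M a b r (suc (suc c)) = M r (suc (suc c)) + a c * M r zero + b c * M r (suc zero)

det-addToLaterColumns : ∀ n (M : Matrix (suc (suc n))) a b
  → det (suc (suc n)) (addToLaterColumns M a b) ≡ det (suc (suc n)) M
det-addToLaterColumns n M a b = begin
    det (suc (suc n)) (addToLaterColumns M a b)
  ≡⟨ det-cong (suc (suc n)) as-two-steps ⟩
    det (suc (suc n)) (λ r c → M₁ r c + later a c * M₁ r zero)
  ≡⟨ det-addColumnMultiples (suc (suc n)) M₁ zero (later a) refl ⟩
    det (suc (suc n)) M₁
  ≡⟨ det-addColumnMultiples (suc (suc n)) M (suc zero) (later b) refl ⟩
    det (suc (suc n)) M
  ∎
  where
  later : (Fin n → ℤ) → Fin (suc (suc n)) → ℤ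
  later f zero          = 0ℤ
  later f (suc zero)    = 0ℤ
  later f (suc (suc c)) = f c
  M₁ : Matrix (suc (suc n))
  M₁ r c = M r c + later b c * M r (suc zero)
  unchanged : ∀ u v → u ≡ (u + 0ℤ * v) + 0ℤ * (u + 0ℤ * v)
  unchanged = solve-∀
  reorder : ∀ m u v x y → m + x * u + y * v ≡ (m + y * v) + x * (u + 0ℤ * v)
  reorder = solve-∀
  as-two-steps : ∀ r c → addToLaterColumns M a b r c ≡ M₁ r c + later a c * M₁ r zero
  as-two-steps r zero          = unchanged (M r zero) (M r (suc zero))
  as-two-steps r (suc zero)    = unchanged (M r (suc zero)) (M r (suc zero))
  as-two-steps r (suc (suc c)) = reorder (M r (suc (suc c))) (M r zero) (M r (suc zero)) (a c) (b c)

det-sparseRow : ∀ n (M : Matrix (suc n)) z → (∀ c → M z (suc c) ≡ 0ℤ)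
  → det (suc n) M ≡ cofactorTerm M z
det-sparseRow n M z row≡0 = sumFin-concentrated n (cofactorTerm M) z λ r →
  let p = punchIn z r in trans (cong (sign p * M p zero *_) (minor-singular r)) (*-zeroʳ (sign p * M p zero))
  where
  minor-singular : ∀ r → det n (minor M (punchIn z r)) ≡ 0ℤ
  minor-singular r = det-zeroRow n _ (punchOut (punchInᵢ≢i z r)) λ c →
    trans (cong (λ t → M t (suc c)) (punchIn-punchOut (punchInᵢ≢i z r))) (row≡0 c)

det-skewBlock : ∀ n (P : Matrix (suc (suc n)))
  → P zero (suc zero) ≡ 1ℤ → P (suc zero) zero ≡ -1ℤ
  → (∀ c → P zero (suc (suc c)) ≡ 0ℤ) → (∀ c → P (suc zero) (suc c) ≡ 0ℤ)
  → det (suc (suc n)) P ≡ det n (λ r c → P (suc (suc r)) (suc (suc c)))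
det-skewBlock n P P₀₁ P₁₀ row₀ row₁ = begin
    det (suc (suc n)) P
  ≡⟨ det-sparseRow (suc n) P (suc zero) row₁ ⟩
    -1ℤ * P (suc zero) zero * det (suc n) (minor P (suc zero))
  ≡⟨ cong₂ (λ a d → -1ℤ * a * d) P₁₀ (det-sparseRow n (minor P (suc zero)) zero row₀) ⟩
    -1ℤ * -1ℤ * (1ℤ * P zero (suc zero) * det n lower)
  ≡⟨ cong (λ a → -1ℤ * -1ℤ * (1ℤ * a * det n lower)) P₀₁ ⟩
    -1ℤ * -1ℤ * (1ℤ * 1ℤ * det n lower)
  ≡⟨ units (det n lower) ⟩
    det n lower
  ∎
  where
  lower : Matrix n
  lower r c = P (suc (suc r)) (suc (suc c))
  units : ∀ d → -1ℤ * -1ℤ * (1ℤ * 1ℤ * d) ≡ d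
  units = solve-∀

ifEq : ∀ {n} → Fin n → Fin n → ℤ → ℤ → ℤ
ifEq c i u v with c ≟ i
... | yes _ = u
... | no  _ = v

ifEq-refl : ∀ {n} (i : Fin n) {u v} → ifEq i i u v ≡ u
ifEq-refl i with i ≟ i
... | yes _   = refl
... | no  i≢i = contradiction refl i≢i

ifEq-≢ : ∀ {n} {c i : Fin n} {u v} → c ≢ i → ifEq c i u v ≡ v
ifEq-≢ {c = c} {i} c≢i with c ≟ i
... | yes c≡i = contradiction c≡i c≢i
... | no  _   = refl

split≟ : ∀ {n} (i : Fin n) {P : Fin n → Set} → P i → (∀ c → c ≢ i → P c) → ∀ c → P c
split≟ i at-i elsewhere c with c ≟ i
... | yes refl = at-i
... | no  c≢i  = elsewhere c c≢i

-- The skew matrix of a tournament whose vertex i is replaced by a directed 3-cycle x → y → z → x: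
-- rows and columns are y, z, and then the original vertices, with x in place of i.
cycleInsertion : ∀ {n} → Matrix n → Fin n → Matrix (suc (suc n))
cycleInsertion S i zero          zero          = 0ℤ
cycleInsertion S i zero          (suc zero)    = 1ℤ
cycleInsertion S i zero          (suc (suc c)) = ifEq c i -1ℤ (S i c)
cycleInsertion S i (suc zero)    zero          = -1ℤ
cycleInsertion S i (suc zero)    (suc zero)    = 0ℤ
cycleInsertion S i (suc zero)    (suc (suc c)) = ifEq c i 1ℤ (S i c)
cycleInsertion S i (suc (suc r)) zero          = ifEq r i 1ℤ (S r i)
cycleInsertion S i (suc (suc r)) (suc zero)    = ifEq r i -1ℤ (S r i)
cycleInsertion S i (suc (suc r)) (suc (suc c)) = S r c

det-cycleInsertion : ∀ n (S : Matrix n) i → S i i ≡ 0ℤ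
  → det (suc (suc n)) (cycleInsertion S i) ≡ + 9 * det n S
det-cycleInsertion n S i Sᵢᵢ≡0 = begin
    det (suc (suc n)) M
  ≡⟨ det-addToLaterColumns n M a b ⟨
    det (suc (suc n)) P
  ≡⟨ det-skewBlock n P refl refl row₀ row₁ ⟩
    det n (λ r c → P (suc (suc r)) (suc (suc c)))
  ≡⟨ det-cong n lower ⟩
    det n (λ r c → weight r * (weight c * S r c))
  ≡⟨ det-scaleRow n i (+ 3) (λ r c r≢i → off-i _ r≢i) (λ c → on-i _) ⟩
    + 3 * det n (λ r c → weight c * S r c)
  ≡⟨ cong (+ 3 *_) (det-scaleCol n i (+ 3) (λ r c c≢i → off-i _ c≢i) (λ r → on-i _)) ⟩
    + 3 * (+ 3 * det n S)
  ≡⟨ three-times-three (det n S) ⟩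
    + 9 * det n S
  ∎
  where
  M : Matrix (suc (suc n))
  M = cycleInsertion S i
  a b : Fin n → ℤ
  a c = ifEq c i 1ℤ (S i c)
  b c = ifEq c i 1ℤ (- S i c)
  P : Matrix (suc (suc n))
  P = addToLaterColumns M a b
  weight : Fin n → ℤ
  weight c = ifEq c i (+ 3) 1ℤ

  row₀ : ∀ c → P zero (suc (suc c)) ≡ 0ℤ
  row₀ c with c ≟ i
  ... | yes _ = refl
  ... | no  _ = cancel (S i c)
    where cancel : ∀ s → s + s * 0ℤ + (- s) * 1ℤ ≡ 0ℤ
          cancel = solve-∀
  row₁ : ∀ c → P (suc zero) (suc c) ≡ 0ℤ
  row₁ zero = refl
  row₁ (suc c) with c ≟ i
  ... | yes _ = refl
  ... | no  _ = cancel (S i c)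
    where cancel : ∀ s → s + s * -1ℤ + (- s) * 0ℤ ≡ 0ℤ
          cancel = solve-∀
  lower : ∀ r c → P (suc (suc r)) (suc (suc c)) ≡ weight r * (weight c * S r c)
  lower r c with r ≟ i | c ≟ i
  ... | yes refl | yes refl rewrite Sᵢᵢ≡0 = refl
  ... | yes refl | no  _    = tripled (S i c)
    where tripled : ∀ s → s + s * 1ℤ + (- s) * -1ℤ ≡ + 3 * (1ℤ * s)
          tripled = solve-∀
  ... | no  _    | yes refl = tripled (S r i)
    where tripled : ∀ s → s + 1ℤ * s + 1ℤ * s ≡ 1ℤ * (+ 3 * s)
          tripled = solve-∀
  ... | no  _    | no  _    = unchanged (S r c) (S i c) (S r i)
    where unchanged : ∀ s u v → s + u * v + (- u) * v ≡ 1ℤ * (1ℤ * s)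
          unchanged = solve-∀
  off-i : ∀ {r} x → r ≢ i → weight r * x ≡ x
  off-i x r≢i = trans (cong (_* x) (ifEq-≢ r≢i)) (*-identityˡ x)
  on-i : ∀ x → weight i * x ≡ + 3 * x
  on-i x = cong (_* x) (ifEq-refl i)
  three-times-three : ∀ d → + 3 * (+ 3 * d) ≡ + 9 * d
  three-times-three = solve-∀

skew-cong : ∀ {m m′} (a : Arcs (Fin m)) (b : Arcs (Fin m′)) {r c r′ c′}
  → a r c ≡ b r′ c′ → a c r ≡ b c′ r′ → skew a r c ≡ skew b r′ c′
skew-cong a b rc cr rewrite rc | cr = refl

skew-loop : ∀ {m} (a : Arcs (Fin m)) {u} → a u u ≡ false → skew a u u ≡ 0ℤ
skew-loop a loop rewrite loop = refl

skew-arc : ∀ {m} (a : Arcs (Fin m)) {u v} → a u v ≡ true → skew a u v ≡ 1ℤ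
skew-arc a arc rewrite arc = refl

arc-irreflexive : ∀ {V} (a : Arcs V) → (∀ v → a v v ≡ false)
  → ∀ {u v} → a u v ≡ true → u ≢ v
arc-irreflexive a loopless arc refl = contradiction (trans (sym arc) (loopless _)) λ ()

arc-asymmetric : ∀ {V} (a : Arcs V) → IsTournament a → ∀ {u v} → a u v ≡ true → a v u ≡ false
arc-asymmetric a (loopless , opposite) arc =
  trans (opposite _ _ (arc-irreflexive a loopless arc ∘ sym)) (cong not arc)

skew-reversedArc : ∀ {m} (a : Arcs (Fin m)) {u v} → IsTournament a
  → a u v ≡ true → skew a v u ≡ -1ℤ
skew-reversedArc a tournament arc rewrite arc-asymmetric a tournament arc | arc = refl

module _ {n} (A : Arcs (Fin n)) (k : Fin n → ℕ) (T : (j : Fin n) → Arcs (Fin (k j))) where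

  blowup-within : ∀ j x y → blowup A k T (j , x) (j , y) ≡ T j x y
  blowup-within j x y with j ≟ j
  ... | yes refl = refl
  ... | no  j≢j  = contradiction refl j≢j

  blowup-between : ∀ {j l} x y → j ≢ l → blowup A k T (j , x) (l , y) ≡ A j l
  blowup-between {j} {l} x y j≢l with j ≟ l
  ... | yes j≡l = contradiction j≡l j≢l
  ... | no  _   = refl

  skew-blowup-within : ∀ {m} (f : Fin m → Σ (Fin n) (Fin ∘ k)) r c {j x y}
    → f r ≡ (j , x) → f c ≡ (j , y) → skew (induced (blowup A k T) f) r c ≡ skew (T j) x y
  skew-blowup-within f r c {j} fr fc =
    skew-cong (induced (blowup A k T) f) (T j) (trans (cong₂ (blowup A k T) fr fc) (blowup-within _ _ _))
              (trans (cong₂ (blowup A k T) fc fr) (blowup-within _ _ _))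

  skew-blowup-between : ∀ {m} (f : Fin m → Σ (Fin n) (Fin ∘ k)) r c {j l x y}
    → f r ≡ (j , x) → f c ≡ (l , y) → j ≢ l → skew (induced (blowup A k T) f) r c ≡ skew A j l
  skew-blowup-between f r c fr fc j≢l =
    skew-cong (induced (blowup A k T) f) A (trans (cong₂ (blowup A k T) fr fc) (blowup-between _ _ j≢l))
              (trans (cong₂ (blowup A k T) fc fr) (blowup-between _ _ (j≢l ∘ sym)))

module CycleInBlowup {n} (A : Arcs (Fin n)) (k : Fin n → ℕ) (T : (j : Fin n) → Arcs (Fin (k j)))
  (A-loopless : ∀ j → A j j ≡ false) (T-tournament : ∀ j → IsTournament (T j))
  (rep : (j : Fin n) → Fin (k j))
  {i : Fin n} {x y z : Fin (k i)}
  (x→y : T i x y ≡ true) (y→z : T i y z ≡ true) (z→x : T i z x ≡ true)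
  where

  representative : (j : Fin n) → Fin (k j)
  representative j with j ≟ i
  ... | yes refl = x
  ... | no  _    = rep j

  representative-i : representative i ≡ x
  representative-i with i ≟ i
  ... | yes refl = refl
  ... | no  i≢i  = contradiction refl i≢i

  vertices : Fin (suc (suc n)) → Σ (Fin n) (Fin ∘ k)
  vertices zero          = i , y
  vertices (suc zero)    = i , z
  vertices (suc (suc j)) = j , representative j

  private
    T-loopless : ∀ v → T i v v ≡ false
    T-loopless = proj₁ (T-tournament i)

    x≢y : x ≢ y
    x≢y = arc-irreflexive (T i) T-loopless x→y
    y≢z : y ≢ z
    y≢z = arc-irreflexive (T i) T-loopless y→z
    z≢x : z ≢ x
    z≢x = arc-irreflexive (T i) T-loopless z→x

    second : ∀ {j} {a b : Fin (k j)} → _≡_ {A = Σ (Fin n) (Fin ∘ k)} (j , a) (j , b) → a ≡ b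
    second refl = refl

    representative-hit : ∀ j a → (j , representative j) ≡ (i , a) → x ≡ a
    representative-hit j a e with ,-injectiveˡ e
    ... | refl = trans (sym representative-i) (second e)

  vertices-injective : Injective vertices
  vertices-injective zero          zero          _ = refl
  vertices-injective zero          (suc zero)    e = contradiction (second e) y≢z
  vertices-injective zero          (suc (suc j)) e = contradiction (representative-hit j y (sym e)) x≢y
  vertices-injective (suc zero)    zero          e = contradiction (second (sym e)) y≢z
  vertices-injective (suc zero)    (suc zero)    _ = refl
  vertices-injective (suc zero)    (suc (suc j)) e = contradiction (sym (representative-hit j z (sym e))) z≢x
  vertices-injective (suc (suc j)) zero          e = contradiction (representative-hit j y e) x≢y
  vertices-injective (suc (suc j)) (suc zero)    e = contradiction (sym (representative-hit j z e)) z≢x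
  vertices-injective (suc (suc j)) (suc (suc l)) e = cong (λ j → suc (suc j)) (,-injectiveˡ e)

  private
    B : Arcs (Σ (Fin n) (Fin ∘ k))
    B = blowup A k T

    within : ∀ r c {j a b} → vertices r ≡ (j , a) → vertices c ≡ (j , b)
      → skew (induced B vertices) r c ≡ skew (T j) a b
    within = skew-blowup-within A k T vertices

    between : ∀ r c {j l a b} → vertices r ≡ (j , a) → vertices c ≡ (l , b) → j ≢ l
      → skew (induced B vertices) r c ≡ skew A j l
    between = skew-blowup-between A k T vertices

    to-x : vertices (suc (suc i)) ≡ (i , x)
    to-x = cong (i ,_) representative-i

    loop : ∀ v → skew (T i) v v ≡ 0ℤ
    loop v = skew-loop (T i) (T-loopless v)

    forward : ∀ {u v} → T i u v ≡ true → skew (T i) u v ≡ 1ℤ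
    forward = skew-arc (T i)

    backward : ∀ {u v} → T i u v ≡ true → skew (T i) v u ≡ -1ℤ
    backward = skew-reversedArc (T i) (T-tournament i)

    at-x : ∀ {e u v} → e ≡ u → e ≡ ifEq i i u v
    at-x e≡u = trans e≡u (sym (ifEq-refl i))

    off-x : ∀ {c e u v} → c ≢ i → e ≡ v → e ≡ ifEq c i u v
    off-x c≢i e≡v = trans e≡v (sym (ifEq-≢ c≢i))

  skew-vertices : ∀ r c → skew (induced B vertices) r c ≡ cycleInsertion (skew A) i r c
  skew-vertices zero       zero       = trans (within zero zero refl refl) (loop y)
  skew-vertices zero       (suc zero) = trans (within zero (suc zero) refl refl) (forward y→z)
  skew-vertices (suc zero) zero       = trans (within (suc zero) zero refl refl) (backward y→z)
  skew-vertices (suc zero) (suc zero) = trans (within (suc zero) (suc zero) refl refl) (loop z)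
  skew-vertices zero (suc (suc c)) = split≟ i
    (at-x (trans (within zero (suc (suc i)) refl to-x) (backward x→y)))
    (λ c c≢i → off-x c≢i (between zero (suc (suc c)) refl refl (c≢i ∘ sym))) c
  skew-vertices (suc zero) (suc (suc c)) = split≟ i
    (at-x (trans (within (suc zero) (suc (suc i)) refl to-x) (forward z→x)))
    (λ c c≢i → off-x c≢i (between (suc zero) (suc (suc c)) refl refl (c≢i ∘ sym))) c
  skew-vertices (suc (suc r)) zero = split≟ i
    (at-x (trans (within (suc (suc i)) zero to-x refl) (forward x→y)))
    (λ r r≢i → off-x r≢i (between (suc (suc r)) zero refl refl r≢i)) r
  skew-vertices (suc (suc r)) (suc zero) = split≟ i
    (at-x (trans (within (suc (suc i)) (suc zero) to-x refl) (backward z→x)))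
    (λ r r≢i → off-x r≢i (between (suc (suc r)) (suc zero) refl refl r≢i)) r
  skew-vertices (suc (suc r)) (suc (suc c)) = split≟ r
    (trans (within (suc (suc r)) (suc (suc r)) refl refl)
           (trans (skew-loop (T r) (proj₁ (T-tournament r) _)) (sym (skew-loop A (A-loopless r)))))
    (λ c c≢r → between (suc (suc r)) (suc (suc c)) refl refl (c≢r ∘ sym)) c

threeCycle? : ∀ {m} (t : Arcs (Fin m))
  → Dec (Σ (Fin m) λ a → Σ (Fin m) λ b → Σ (Fin m) λ c →
           (t a b ≡ true) × (t b c ≡ true) × (t c a ≡ true))
threeCycle? t = any? λ a → any? λ b → any? λ c →
  (t a b Bool.≟ true) ×-dec (t b c Bool.≟ true) ×-dec (t c a Bool.≟ true)

proposition3p5 : (n : ℕ) → 2 ≤ n → (R : Tournament n)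
    → (k : Fin n → ℕ) → (∀ j → 1 ≤ k j)
    → (T : (j : Fin n) → Tournament (k j))
    → Σ (Fin n) (λ i → ¬ IsTransitive (proj₁ (T i)))
    → Σ ℕ λ m → Σ (Fin m → Σ (Fin n) λ j → Fin (k j)) λ f →
        (1 ≤ m) × Injective f ×
        (detT (induced (blowup (proj₁ R) k (λ j → proj₁ (T j))) f) ≡ + 9 * detT (proj₁ R))
proposition3p5 n _ (A , A-tournament) k k≥1 T (i , Tᵢ-intransitive)
  with decidable-stable (threeCycle? (proj₁ (T i))) Tᵢ-intransitive
... | x , y , z , x→y , y→z , z→x =
  suc (suc n) , vertices , s≤s z≤n , vertices-injective , (begin
    det (suc (suc n)) (skew (induced (blowup A k arcs) vertices))
  ≡⟨ det-cong (suc (suc n)) skew-vertices ⟩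
    det (suc (suc n)) (cycleInsertion (skew A) i)
  ≡⟨ det-cycleInsertion n (skew A) i (skew-loop A (proj₁ A-tournament i)) ⟩
    + 9 * det n (skew A)
  ∎)
  where
  arcs : (j : Fin n) → Arcs (Fin (k j))
  arcs j = proj₁ (T j)
  open CycleInBlowup A k arcs (proj₁ A-tournament) (λ j → proj₂ (T j)) (λ j → fromℕ< (k≥1 j))
                     x→y y→z z→x
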